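{- Let $G$ be a connected cubic bipartite graph and let $\Gamma\subset\mathbb{Z}^3$ be (the union of the cubes of) a lattice drawing of $G$ in which, for each edge $uv$, the cubes $f(u)$ and $f(v)$ have opposite parity. Consider any tiling of $\Gamma$ by dominoes ($2\times1\times1$ bricks), and let $M$ be the set of edges of $G$ whose wires are partitioned into dominoes of the tiling (i.e.\ every cube of the wire, including both endpoints, lies in a domino contained in that wire). Then $M$ is a perfect matching of $G$.
   Context: Elements of $\mathbb{Z}^3$ are called cubes; two cubes are adjacent if they differ by $1$ in exactly one coordinate. A wire between cubes $u,v$ is a sequence of distinct cubes $u=c_1,\dots,c_t=v$ such that $c_i,c_j$ are adjacent iff $|i-j|=1$; $c_1,c_t$ are its endpoints and $c_2,\dots,c_{t-1}$ its interior. A collection of wires is proper if no wire meets the interior of another wire, and two cubes in the union of the wires are adjacent iff they are consecutive elements in (precisely) one wire. A lattice drawing of a graph $G$ consists of an injective map $f:V(G)\to\mathbb{Z}^3$ and, for each edge $uv$, a wire connecting $f(u)$ and $f(v)$, such that the collection of these wires is proper; the region is the union of all these wires. The parity of $(x,y,z)$ is $x+y+z\bmod 2$. A domino tiling of a region is a partition into pairs of adjacent cubes. -}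

module Defs where

open import Level using (0ℓ)
open import Data.Nat using (ℕ; zero; suc; _%_)
open import Data.Integer using (ℤ; _+_; _-_; ∣_∣)
open import Data.Fin using (Fin; toℕ; inject₁; fromℕ)
open import Data.Fin.Properties using (_≟_)
open import Data.Bool using (Bool)
open import Data.List using (List; length; filter; lookup; allFin)
open import Data.Product using (Σ; ∃; _×_; _,_; proj₁; proj₂)
open import Data.Sum using (_⊎_)
open import Relation.Binary.PropositionalEquality using (_≡_; _≢_)
open import Relation.Nullary using (¬_)
open import Relation.Nullary.Decidable using (_⊎-dec_)
open import Function using (Injective; _⇔_)

Cube : Set
Cube = ℤ × ℤ × ℤ

Adj : Cube → Cube → Set
Adj (x , y , z) (x' , y' , z') =
    (∣ x - x' ∣ ≡ 1 × y ≡ y' × z ≡ z')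
  ⊎ (x ≡ x' × ∣ y - y' ∣ ≡ 1 × z ≡ z')
  ⊎ (x ≡ x' × y ≡ y' × ∣ z - z' ∣ ≡ 1)

parity : Cube → ℕ
parity (x , y , z) = ∣ x + y + z ∣ % 2

ExactlyOne : {A : Set} → (A → Set) → Set
ExactlyOne {A} P = Σ A λ a → P a × (∀ b → P b → b ≡ a)

record Graph : Set where
  field
    n : ℕ
    m : ℕ
    src : Fin m → Fin n
    tgt : Fin m → Fin n
    loopless : ∀ e → src e ≢ tgt e
    simple : ∀ e e' → (src e ≡ src e' × tgt e ≡ tgt e')
                    ⊎ (src e ≡ tgt e' × tgt e ≡ src e') → e ≡ e'

module _ (G : Graph) where
  open Graph G

  Incident : Fin n → Fin m → Set
  Incident v e = v ≡ src e ⊎ v ≡ tgt e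

  degree : Fin n → ℕ
  degree v = length (filter (λ e → (v ≟ src e) ⊎-dec (v ≟ tgt e)) (allFin m))

  Cubic : Set
  Cubic = ∀ v → degree v ≡ 3

  data Reach : Fin n → Fin n → Set where
    here : ∀ {v} → Reach v v
    step : ∀ {u w} e → Incident u e → Incident w e → ∀ {v} → Reach w v → Reach u v

  Connected : Set
  Connected = ∀ u v → Reach u v

  Bipartite : Set
  Bipartite = Σ (Fin n → Bool) λ col → ∀ e → col (src e) ≢ col (tgt e)

  PerfectMatching : (Fin m → Set) → Set
  PerfectMatching M = ∀ v → ExactlyOne (λ e → Incident v e × M e)

record IsWire (u v : Cube) (len : ℕ) (c : Fin (suc len) → Cube) : Set where
  field
    start    : c Data.Fin.zero ≡ u
    end      : c (fromℕ len) ≡ v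
    distinct : Injective _≡_ _≡_ c
    adj-iff  : ∀ i j → Adj (c i) (c j) ⇔ (toℕ i ≡ suc (toℕ j) ⊎ toℕ j ≡ suc (toℕ i))

Interior : ℕ → ℕ → Set
Interior len i = ¬ (i ≡ 0) × ¬ (i ≡ len)

record LatticeDrawing (G : Graph) : Set where
  open Graph G
  field
    f      : Fin n → Cube
    f-inj  : Injective _≡_ _≡_ f
    len    : Fin m → ℕ
    wire   : (e : Fin m) → Fin (suc (len e)) → Cube
    isWire : ∀ e → IsWire (f (src e)) (f (tgt e)) (len e) (wire e)

  InWire : Fin m → Cube → Set
  InWire e x = Σ (Fin (suc (len e))) λ i → wire e i ≡ x

  InRegion : Cube → Set
  InRegion x = Σ (Fin m) λ e → InWire e x

  Consecutive : Fin m → Cube → Cube → Set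
  Consecutive e a b = Σ (Fin (len e)) λ i →
      (wire e (inject₁ i) ≡ a × wire e (Data.Fin.suc i) ≡ b)
    ⊎ (wire e (inject₁ i) ≡ b × wire e (Data.Fin.suc i) ≡ a)

  field
    proper-interior : ∀ e e' → e ≢ e' → ∀ (i : Fin (suc (len e))) →
      Interior (len e) (toℕ i) → ¬ InWire e' (wire e i)
    proper-adj : ∀ a b → InRegion a → InRegion b →
      Adj a b ⇔ ExactlyOne (λ e → Consecutive e a b)

Domino : Set
Domino = Cube × Cube

InDomino : Cube → Domino → Set
InDomino x (a , b) = x ≡ a ⊎ x ≡ b

record IsDominoTiling (Region : Cube → Set) (T : List Domino) : Set where
  field
    dom-adj    : ∀ k → Adj (proj₁ (lookup T k)) (proj₂ (lookup T k))
    dom-region : ∀ k → Region (proj₁ (lookup T k)) × Region (proj₂ (lookup T k))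
    partition  : ∀ x → Region x → ExactlyOne (λ k → InDomino x (lookup T k))

module _ {G : Graph} (D : LatticeDrawing G) (T : List Domino) where
  open Graph G
  open LatticeDrawing D

  WireTiled : Fin m → Set
  WireTiled e = ∀ (i : Fin (suc (len e))) → Σ (Fin (length T)) λ k →
    InDomino (wire e i) (lookup T k)
      × InWire e (proj₁ (lookup T k)) × InWire e (proj₂ (lookup T k))

-- Along a wire adjacent cubes have opposite parity, so a wire whose end cubes
-- have opposite parity consists of an even number 2q + 2 of cubes. Interior cubes
-- of a wire lie on no other wire, so the domino covering one of them lies along
-- that wire and pairs it with a neighbour. Hence once an end cube of the wire of
-- e is paired along the wire, the pairing propagates and cuts the wire into
-- {c₀, c₁}, {c₂, c₃}, …, so e ∈ M. Every vertex v has such an edge: the domino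
-- covering f(v) lies along some wire, which ends at f(v) since f(v) is interior
-- to no wire. Conversely, if two edges at v are in M, the domino covering f(v)
-- lies along both wires, and properness makes the edges equal.
module Submission where

open import Defs
open import Data.Fin as Fin using (Fin; toℕ; inject₁; fromℕ; fromℕ<)
open import Data.Fin.Properties
  using (toℕ-injective; toℕ<n; toℕ-fromℕ; toℕ-fromℕ<; fromℕ<-toℕ; toℕ-inject₁)
open import Data.Integer as ℤ using (ℤ; +_; -[1+_]; ∣_∣; 1ℤ; -1ℤ)
open import Data.Integer.Properties using ()
  renaming (+-assoc to ℤ-+-assoc; +-identityʳ to ℤ-+-identityʳ)
open import Data.Integer.Tactic.RingSolver using (solve-∀)
open import Data.List using (List; length; lookup; allFin)
open import Data.List.Relation.Unary.All using (All; _∷_)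
open import Data.List.Relation.Unary.All.Properties using (all-filter)
import Data.Nat as ℕ
open import Data.Nat using (ℕ; zero; suc; _+_; _≤_; _<_; _≤?_; _<?_; z≤n; s≤s; _%_)
open import Data.Nat.DivMod using (m%n<n; [m+n]%n≡m%n)
open import Data.Nat.Properties
  using (+-comm; +-suc; +-mono-≤; +-mono-<; ≤-trans; ≤-refl; n≤1+n; ≤-pred; <⇒≤; <⇒≢; ≰⇒>;
         1+n≰n; 1+n≢n; m≢1+n+m; suc-injective)
open import Data.Product using (Σ; ∃; _×_; _,_; proj₁; proj₂)
open import Data.Sum using (_⊎_; inj₁; inj₂)
open import Function using (Equivalence; _∘_)
open import Relation.Binary.PropositionalEquality
open import Relation.Nullary using (¬_; yes; no; contradiction)
open import Relation.Nullary.Decidable using (_⊎-dec_)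

open Equivalence using (to; from)

%2-suc≢ : ∀ n → suc n % 2 ≢ n % 2
%2-suc≢ zero ()
%2-suc≢ (suc n) eq = %2-suc≢ n (sym (trans (sym %2-suc-suc) eq))
  where
  %2-suc-suc : suc (suc n) % 2 ≡ n % 2
  %2-suc-suc = trans (cong (_% 2) (+-comm 2 n)) ([m+n]%n≡m%n n 2)

%2-neighbours≢ : ∀ {m n} → m ≡ suc n ⊎ suc m ≡ n → m % 2 ≢ n % 2
%2-neighbours≢ {n = n} (inj₁ refl) = %2-suc≢ n
%2-neighbours≢ {m = m} (inj₂ refl) = %2-suc≢ m ∘ sym

∣+1∣-neighbours : ∀ s → ∣ s ℤ.+ 1ℤ ∣ ≡ suc ∣ s ∣ ⊎ suc ∣ s ℤ.+ 1ℤ ∣ ≡ ∣ s ∣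
∣+1∣-neighbours (+ n)          = inj₁ (+-comm n 1)
∣+1∣-neighbours -[1+ zero ]    = inj₂ refl
∣+1∣-neighbours -[1+ suc n ]   = inj₂ refl

∣t∣≡1⇒±1 : ∀ {t} → ∣ t ∣ ≡ 1 → t ≡ 1ℤ ⊎ t ≡ -1ℤ
∣t∣≡1⇒±1 {+ .1}         refl = inj₁ refl
∣t∣≡1⇒±1 { -[1+ zero ]} refl = inj₂ refl

∣s+t∣%2≢∣s∣%2 : ∀ s {t} → ∣ t ∣ ≡ 1 → ∣ s ℤ.+ t ∣ % 2 ≢ ∣ s ∣ % 2
∣s+t∣%2≢∣s∣%2 s {t} ∣t∣≡1 with ∣t∣≡1⇒±1 {t} ∣t∣≡1
... | inj₁ refl = %2-neighbours≢ (∣+1∣-neighbours s)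
... | inj₂ refl = %2-neighbours≢ (subst Neighbours r+1≡s (∣+1∣-neighbours r)) ∘ sym
  where
  r : ℤ
  r = s ℤ.+ -1ℤ
  r+1≡s : r ℤ.+ 1ℤ ≡ s
  r+1≡s = trans (ℤ-+-assoc s -1ℤ 1ℤ) (ℤ-+-identityʳ s)
  Neighbours : ℤ → Set
  Neighbours u = ∣ u ∣ ≡ suc ∣ r ∣ ⊎ suc ∣ u ∣ ≡ ∣ r ∣

coordinateSum : Cube → ℤ
coordinateSum (x , y , z) = x ℤ.+ y ℤ.+ z

Adj⇒coordinateSum-shift : ∀ {a b} → Adj a b →
  Σ ℤ λ d → ∣ d ∣ ≡ 1 × coordinateSum a ≡ coordinateSum b ℤ.+ d
Adj⇒coordinateSum-shift {x , y , z} {x' , _ , _} (inj₁ (h , refl , refl)) =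
  x ℤ.- x' , h , shift x x' y z
  where
  shift : ∀ x x' y z → x ℤ.+ y ℤ.+ z ≡ x' ℤ.+ y ℤ.+ z ℤ.+ (x ℤ.- x')
  shift = solve-∀
Adj⇒coordinateSum-shift {x , y , z} {_ , y' , _} (inj₂ (inj₁ (refl , h , refl))) =
  y ℤ.- y' , h , shift x y y' z
  where
  shift : ∀ x y y' z → x ℤ.+ y ℤ.+ z ≡ x ℤ.+ y' ℤ.+ z ℤ.+ (y ℤ.- y')
  shift = solve-∀
Adj⇒coordinateSum-shift {x , y , z} {_ , _ , z'} (inj₂ (inj₂ (refl , refl , h))) =
  z ℤ.- z' , h , shift x y z z'
  where
  shift : ∀ x y z z' → x ℤ.+ y ℤ.+ z ≡ x ℤ.+ y ℤ.+ z' ℤ.+ (z ℤ.- z')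
  shift = solve-∀

Adj⇒parity≢ : ∀ {a b} → Adj a b → parity a ≢ parity b
Adj⇒parity≢ {b = b} adj with Adj⇒coordinateSum-shift adj
... | d , ∣d∣≡1 , a≡b+d rewrite a≡b+d = ∣s+t∣%2≢∣s∣%2 (coordinateSum b) ∣d∣≡1

parity<2 : ∀ a → parity a < 2
parity<2 a = m%n<n ∣ coordinateSum a ∣ 2

≢-≢⇒≡-<2 : ∀ {a b c} → a < 2 → b < 2 → c < 2 → a ≢ b → b ≢ c → a ≡ c
≢-≢⇒≡-<2 {0}     {0}           _ _ _ a≢b _   = contradiction refl a≢b
≢-≢⇒≡-<2 {1}     {1}           _ _ _ a≢b _   = contradiction refl a≢b
≢-≢⇒≡-<2 {0}     {1}     {0}   _ _ _ _   _   = refl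
≢-≢⇒≡-<2 {1}     {0}     {1}   _ _ _ _   _   = refl
≢-≢⇒≡-<2 {0}     {1}     {1}   _ _ _ _   b≢c = contradiction refl b≢c
≢-≢⇒≡-<2 {1}     {0}     {0}   _ _ _ _   b≢c = contradiction refl b≢c
≢-≢⇒≡-<2 {suc (suc _)} (s≤s (s≤s ())) _ _ _ _
≢-≢⇒≡-<2 {_} {suc (suc _)} _ (s≤s (s≤s ())) _ _ _
≢-≢⇒≡-<2 {0} {1} {suc (suc _)} _ _ (s≤s (s≤s ())) _ _
≢-≢⇒≡-<2 {1} {0} {suc (suc _)} _ _ (s≤s (s≤s ())) _ _

double-suc : ∀ k → suc k + suc k ≡ suc (suc (k + k))
double-suc k = cong suc (+-suc k k)

even-or-odd : ∀ n → ∃ λ k → n ≡ k + k ⊎ n ≡ suc (k + k)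
even-or-odd zero = 0 , inj₁ refl
even-or-odd (suc n) with even-or-odd n
... | k , inj₁ refl = k , inj₂ refl
... | k , inj₂ refl = suc k , inj₁ (sym (double-suc k))

half-≤ : ∀ {h q} → h + h ≤ suc (q + q) → h ≤ q
half-≤ {h} {q} h+h≤ with h ≤? q
... | yes h≤q = h≤q
... | no h≰q  = contradiction (≤-trans 2q+2≤h+h h+h≤) 1+n≰n
  where
  q<h = ≰⇒> h≰q
  2q+2≤h+h = subst (_≤ h + h) (double-suc q) (+-mono-≤ q<h q<h)

alternating⇒odd-length : ∀ {L} (p : ℕ → ℕ) → (∀ i → p i < 2) →
  (∀ {i} → suc i ≤ L → p (suc i) ≢ p i) → p L ≢ p 0 → ∃ λ q → L ≡ suc (q + q)
alternating⇒odd-length {L} p p<2 alternates pL≢p0 with even-or-odd L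
... | q , inj₂ L-odd  = q , L-odd
... | q , inj₁ L-even =
  contradiction (trans (cong p L-even) (even-index q (subst (_≤ L) L-even ≤-refl))) pL≢p0
  where
  even-index : ∀ k → k + k ≤ L → p (k + k) ≡ p 0
  even-index zero _ = refl
  even-index (suc k) 2k+2≤L =
    trans (cong p (double-suc k))
      (trans (≢-≢⇒≡-<2 (p<2 _) (p<2 _) (p<2 _) (alternates 2k+2≤L') (alternates 2k+1≤L))
             (even-index k (≤-trans (n≤1+n _) 2k+1≤L)))
    where
    2k+2≤L' = subst (_≤ L) (double-suc k) 2k+2≤L
    2k+1≤L = ≤-trans (n≤1+n _) 2k+2≤L'

-- Paired models the pairing of the cubes c₀ … c₂q₊₁ of a wire by the tiling. Once
-- some pair {2k, 2k+1} is present, the pairing propagates in both directions,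
-- since the neighbour on the near side of the next index is already taken.
module PathPairing (q : ℕ) (Paired : ℕ → ℕ → Set)
  (Paired-sym : ∀ {i j} → Paired i j → Paired j i)
  (Paired-functional : ∀ {i j k} → Paired i j → Paired i k → j ≡ k)
  (interior : ∀ {i} → suc i < suc (q + q) → Paired (suc i) i ⊎ Paired (suc i) (suc (suc i)))
  where

  EvenPair : ℕ → Set
  EvenPair k = Paired (k + k) (suc (k + k))

  EvenPair-suc : ∀ {k} → Paired (suc (suc (k + k))) (suc (suc (suc (k + k)))) → EvenPair (suc k)
  EvenPair-suc {k} = subst₂ Paired (sym (double-suc k)) (cong suc (sym (double-suc k)))

  EvenPair-suc⁻ : ∀ {k} → EvenPair (suc k) → Paired (suc (suc (k + k))) (suc (suc (suc (k + k))))
  EvenPair-suc⁻ {k} = subst₂ Paired (double-suc k) (cong suc (double-suc k))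

  pairs-up : ∀ {k} → k < q → EvenPair k → EvenPair (suc k)
  pairs-up {k} k<q pair
    with interior {suc (k + k)} (s≤s (subst (_≤ q + q) (double-suc k) (+-mono-≤ k<q k<q)))
  ... | inj₁ back = contradiction (Paired-functional (Paired-sym pair) (Paired-sym back))
                                  (m≢1+n+m (k + k) {1})
  ... | inj₂ fwd  = EvenPair-suc fwd

  pairs-down : ∀ {k} → k < q → EvenPair (suc k) → EvenPair k
  pairs-down {k} k<q pair with interior {k + k} (s≤s (+-mono-< k<q k<q))
  ... | inj₁ back = Paired-sym back
  ... | inj₂ fwd  = contradiction (sym (Paired-functional (EvenPair-suc⁻ pair) (Paired-sym fwd)))
                                  (m≢1+n+m (suc (k + k)) {1})

  EvenPair-first : ∀ {k} → k ≤ q → EvenPair k → EvenPair 0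
  EvenPair-first {zero}  _     pair = pair
  EvenPair-first {suc k} 1+k≤q pair =
    EvenPair-first (≤-trans (n≤1+n k) 1+k≤q) (pairs-down 1+k≤q pair)

  EvenPair-all : EvenPair 0 → ∀ {k} → k ≤ q → EvenPair k
  EvenPair-all pair {zero}  _     = pair
  EvenPair-all pair {suc k} 1+k≤q = pairs-up 1+k≤q (EvenPair-all pair (≤-trans (n≤1+n k) 1+k≤q))

  EvenPairs⇒every-index-paired : (∀ {k} → k ≤ q → EvenPair k) →
    ∀ {i} → i ≤ suc (q + q) → ∃ (Paired i)
  EvenPairs⇒every-index-paired evenPair {i} i≤ with even-or-odd i
  ... | h , inj₁ refl = suc (h + h) , evenPair {h} (half-≤ i≤)
  ... | h , inj₂ refl = h + h , Paired-sym (evenPair {h} (half-≤ {h} {q} (≤-trans (n≤1+n _) i≤)))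

  every-index-paired : ∀ {k} → k ≤ q → EvenPair k → ∀ {i} → i ≤ suc (q + q) → ∃ (Paired i)
  every-index-paired k≤q pair = EvenPairs⇒every-index-paired (EvenPair-all (EvenPair-first k≤q pair))

InDomino-pair : ∀ {x y z d} → InDomino x d → InDomino y d → x ≢ y →
  InDomino z d → z ≡ x ⊎ z ≡ y
InDomino-pair (inj₁ refl) (inj₁ refl) x≢y _           = contradiction refl x≢y
InDomino-pair (inj₂ refl) (inj₂ refl) x≢y _           = contradiction refl x≢y
InDomino-pair (inj₁ refl) (inj₂ refl) _   (inj₁ refl) = inj₁ refl
InDomino-pair (inj₁ refl) (inj₂ refl) _   (inj₂ refl) = inj₂ refl
InDomino-pair (inj₂ refl) (inj₁ refl) _   (inj₁ refl) = inj₂ refl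
InDomino-pair (inj₂ refl) (inj₁ refl) _   (inj₂ refl) = inj₁ refl

toℕ≡suc⇒suc : ∀ {n} (k l : Fin (suc n)) → toℕ k ≡ suc (toℕ l) →
  Σ (Fin n) λ t → inject₁ t ≡ l × Fin.suc t ≡ k
toℕ≡suc⇒suc (Fin.suc t) l k≡1+l =
  t , toℕ-injective (trans (toℕ-inject₁ t) (suc-injective k≡1+l)) , refl

Cubic⇒incident : ∀ {G} → Cubic G → ∀ v → ∃ (Incident G v)
Cubic⇒incident {G} cubic v = head (all-filter Incident? (allFin m)) (cubic v)
  where
  open Graph G
  Incident? = λ e → (v Fin.≟ src e) ⊎-dec (v Fin.≟ tgt e)
  head : ∀ {es} → All (Incident G v) es → length es ≡ 3 → ∃ (Incident G v)
  head (inc ∷ _) _ = _ , inc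

module _ {G : Graph} (D : LatticeDrawing G) where
  open Graph G
  open LatticeDrawing D

  LiesAlong : Fin m → Domino → Set
  LiesAlong e d = Consecutive e (proj₁ d) (proj₂ d)

  LiesAlong⇒InWire : ∀ {e d x} → LiesAlong e d → InDomino x d → InWire e x
  LiesAlong⇒InWire (t , inj₁ (a , _)) (inj₁ refl) = inject₁ t , a
  LiesAlong⇒InWire (t , inj₁ (_ , b)) (inj₂ refl) = Fin.suc t , b
  LiesAlong⇒InWire (t , inj₂ (_ , a)) (inj₁ refl) = Fin.suc t , a
  LiesAlong⇒InWire (t , inj₂ (b , _)) (inj₂ refl) = inject₁ t , b

  InWire⇒Consecutive : ∀ {e a b} → InWire e a → InWire e b → Adj a b → Consecutive e a b
  InWire⇒Consecutive {e} (i , refl) (j , refl) adj with to (IsWire.adj-iff (isWire e) i j) adj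
  ... | inj₁ i≡1+j with toℕ≡suc⇒suc i j i≡1+j
  ...   | t , refl , refl = t , inj₂ (refl , refl)
  InWire⇒Consecutive {e} (i , refl) (j , refl) adj | inj₂ j≡1+i with toℕ≡suc⇒suc j i j≡1+i
  ...   | t , refl , refl = t , inj₁ (refl , refl)

  endpoint-InWire : ∀ {v e} → Incident G v e → InWire e (f v)
  endpoint-InWire {e = e} (inj₁ refl) = Fin.zero , IsWire.start (isWire e)
  endpoint-InWire {e = e} (inj₂ refl) = fromℕ (len e) , IsWire.end (isWire e)

  InWire⇒Incident : ∀ {v e e₀} → InWire e (f v) → Incident G v e₀ → Incident G v e
  InWire⇒Incident {v} {e} {e₀} (p , p↦fv) inc₀
    with e₀ Fin.≟ e | toℕ p ℕ.≟ 0 | toℕ p ℕ.≟ len e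
  ... | yes refl | _       | _       = inc₀
  ... | no _     | yes p≡0 | _       =
    inj₁ (f-inj (trans (sym p↦fv)
      (trans (cong (wire e) (toℕ-injective p≡0)) (IsWire.start (isWire e)))))
  ... | no _     | no _    | yes p≡L =
    inj₂ (f-inj (trans (sym p↦fv) (trans (cong (wire e) p≡last) (IsWire.end (isWire e)))))
    where p≡last = toℕ-injective (trans p≡L (sym (toℕ-fromℕ (len e))))
  ... | no e₀≢e  | no p≢0  | no p≢L  =
    contradiction (endpoint-InWire inc₀)
      (subst (λ x → ¬ InWire e₀ x) p↦fv (proper-interior e e₀ (e₀≢e ∘ sym) p (p≢0 , p≢L)))

  module _ {T : List Domino} (tiling : IsDominoTiling InRegion T) where
    open IsDominoTiling tiling

    SameDomino : Cube → Cube → Set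
    SameDomino x y = Σ (Fin (length T)) λ k → InDomino x (lookup T k) × InDomino y (lookup T k)

    domino-unique : ∀ {x k k'} → InRegion x →
      InDomino x (lookup T k) → InDomino x (lookup T k') → k ≡ k'
    domino-unique {x} x∈Γ x∈k x∈k' with partition x x∈Γ
    ... | _ , _ , unique = trans (unique _ x∈k) (sym (unique _ x∈k'))

    SameDomino-functional : ∀ {x y z} → InRegion x → SameDomino x y → SameDomino x z →
      x ≢ y → x ≢ z → y ≡ z
    SameDomino-functional x∈Γ (k , x∈k , y∈k) (k' , x∈k' , z∈k') x≢y x≢z
      with domino-unique x∈Γ x∈k x∈k'
    ... | refl with InDomino-pair x∈k y∈k x≢y z∈k'
    ...   | inj₁ z≡x = contradiction (sym z≡x) x≢z
    ...   | inj₂ z≡y = sym z≡y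

    domino-wire! : ∀ k → ExactlyOne (λ e → LiesAlong e (lookup T k))
    domino-wire! k = to (proper-adj _ _ (proj₁ (dom-region k)) (proj₂ (dom-region k))) (dom-adj k)

    domino-wire : ∀ k → ∃ λ e → LiesAlong e (lookup T k)
    domino-wire k = let e , along , _ = domino-wire! k in e , along

    LiesAlong-unique : ∀ {k e e'} → LiesAlong e (lookup T k) → LiesAlong e' (lookup T k) → e ≡ e'
    LiesAlong-unique {k} along along' =
      let _ , _ , unique = domino-wire! k in trans (unique _ along) (sym (unique _ along'))

    tiled-domino : ∀ {e x} → WireTiled D T e → InWire e x →
      Σ (Fin (length T)) λ k → InDomino x (lookup T k) × LiesAlong e (lookup T k)
    tiled-domino tiled (p , refl) with tiled p
    ... | k , x∈k , a∈e , b∈e = k , x∈k , InWire⇒Consecutive a∈e b∈e (dom-adj k)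

    tiled-edge-unique : ∀ {v e₁ e₂} → Incident G v e₁ → WireTiled D T e₁ →
      Incident G v e₂ → WireTiled D T e₂ → e₁ ≡ e₂
    tiled-edge-unique {e₁ = e₁} inc₁ tiled₁ inc₂ tiled₂
      with tiled-domino tiled₁ (endpoint-InWire inc₁) | tiled-domino tiled₂ (endpoint-InWire inc₂)
    ... | k , v∈k , along₁ | k' , v∈k' , along₂
      with domino-unique (e₁ , endpoint-InWire inc₁) v∈k v∈k'
    ...   | refl = LiesAlong-unique along₁ along₂

    module OnWire (e : Fin m) where
      open IsWire (isWire e)

      L : ℕ
      L = len e

      -- Indices beyond L are sent to 0; all lemmas below only use indices i ≤ L.
      position : ℕ → Fin (suc L)
      position i with i <? suc L
      ... | yes i<1+L = fromℕ< i<1+L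
      ... | no _      = Fin.zero

      cube : ℕ → Cube
      cube i = wire e (position i)

      toℕ-position : ∀ {i} → i ≤ L → toℕ (position i) ≡ i
      toℕ-position {i} i≤L with i <? suc L
      ... | yes i<1+L = toℕ-fromℕ< i<1+L
      ... | no i≮1+L  = contradiction (s≤s i≤L) i≮1+L

      cube-toℕ : ∀ p → cube (toℕ p) ≡ wire e p
      cube-toℕ p with toℕ p <? suc L
      ... | yes p<1+L = cong (wire e) (fromℕ<-toℕ p p<1+L)
      ... | no p≮1+L  = contradiction (toℕ<n p) p≮1+L

      cube-injective : ∀ {i j} → i ≤ L → j ≤ L → cube i ≡ cube j → i ≡ j
      cube-injective i≤L j≤L eq =
        trans (sym (toℕ-position i≤L)) (trans (cong toℕ (distinct eq)) (toℕ-position j≤L))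

      cube-InRegion : ∀ i → InRegion (cube i)
      cube-InRegion i = e , position i , refl

      cube-first : cube 0 ≡ f (src e)
      cube-first = trans (cube-toℕ Fin.zero) start

      cube-last : cube L ≡ f (tgt e)
      cube-last = trans (cong cube (sym (toℕ-fromℕ L))) (trans (cube-toℕ (fromℕ L)) end)

      cube-step-parity≢ : ∀ {i} → suc i ≤ L → parity (cube (suc i)) ≢ parity (cube i)
      cube-step-parity≢ {i} 1+i≤L = Adj⇒parity≢ (from (adj-iff (position (suc i)) (position i))
        (inj₁ (trans (toℕ-position 1+i≤L) (cong suc (sym (toℕ-position i≤L))))))
        where i≤L = ≤-trans (n≤1+n i) 1+i≤L

      odd-length : parity (f (src e)) ≢ parity (f (tgt e)) → ∃ λ q → L ≡ suc (q + q)
      odd-length ends≢ =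
        alternating⇒odd-length (parity ∘ cube) (parity<2 ∘ cube) cube-step-parity≢ λ last≡first →
          ends≢ (trans (cong parity (sym cube-first)) (trans (sym last≡first) (cong parity cube-last)))

      Paired : ℕ → ℕ → Set
      Paired i j = i ≤ L × j ≤ L × i ≢ j × SameDomino (cube i) (cube j)

      Paired-sym : ∀ {i j} → Paired i j → Paired j i
      Paired-sym (i≤L , j≤L , i≢j , k , i∈k , j∈k) = j≤L , i≤L , i≢j ∘ sym , k , j∈k , i∈k

      cube≢ : ∀ {i j} → i ≤ L → j ≤ L → i ≢ j → cube i ≢ cube j
      cube≢ i≤L j≤L i≢j = i≢j ∘ cube-injective i≤L j≤L

      Paired-functional : ∀ {i j k} → Paired i j → Paired i k → j ≡ k
      Paired-functional {i} (i≤L , j≤L , i≢j , same) (_ , k≤L , i≢k , same') =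
        cube-injective j≤L k≤L
          (SameDomino-functional (cube-InRegion i) same same' (cube≢ i≤L j≤L i≢j) (cube≢ i≤L k≤L i≢k))

      cube-toℕ-inject₁ : ∀ t → cube (toℕ t) ≡ wire e (inject₁ t)
      cube-toℕ-inject₁ t = trans (cong cube (sym (toℕ-inject₁ t))) (cube-toℕ (inject₁ t))

      LiesAlong-indices : ∀ {d} → LiesAlong e d →
        ∃ λ j → j < L × InDomino (cube j) d × InDomino (cube (suc j)) d
      LiesAlong-indices (t , inj₁ (a , b)) =
        toℕ t , toℕ<n t , inj₁ (trans (cube-toℕ-inject₁ t) a) , inj₂ (trans (cube-toℕ (Fin.suc t)) b)
      LiesAlong-indices (t , inj₂ (b , a)) =
        toℕ t , toℕ<n t , inj₂ (trans (cube-toℕ-inject₁ t) b) , inj₁ (trans (cube-toℕ (Fin.suc t)) a)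

      LiesAlong⇒neighbour-Paired : ∀ {i k} → i ≤ L → InDomino (cube i) (lookup T k) →
        LiesAlong e (lookup T k) → ∃ λ j → (suc j ≡ i ⊎ j ≡ suc i) × Paired i j
      LiesAlong⇒neighbour-Paired {i} {k} i≤L i∈k along with LiesAlong-indices along
      ... | j , j<L , j∈k , 1+j∈k
        with InDomino-pair j∈k 1+j∈k (cube≢ (<⇒≤ j<L) j<L (1+n≢n ∘ sym)) i∈k
      ...   | inj₁ i≡j with cube-injective i≤L (<⇒≤ j<L) i≡j
      ...     | refl = suc i , inj₂ refl , i≤L , j<L , 1+n≢n ∘ sym , k , i∈k , 1+j∈k
      LiesAlong⇒neighbour-Paired {i} {k} i≤L i∈k along | j , j<L , j∈k , 1+j∈k | inj₂ i≡1+j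
        with cube-injective i≤L j<L i≡1+j
      ...     | refl = j , inj₁ refl , i≤L , <⇒≤ j<L , 1+n≢n , k , i∈k , j∈k

      interior-LiesAlong : ∀ {i k} → 0 < i → i < L →
        InDomino (cube i) (lookup T k) → LiesAlong e (lookup T k)
      interior-LiesAlong {i} {k} 0<i i<L i∈k with domino-wire k
      ... | e' , along with e' Fin.≟ e
      ...   | yes refl = along
      ...   | no e'≢e  = contradiction (LiesAlong⇒InWire along i∈k)
                           (proper-interior e e' (e'≢e ∘ sym) (position i) (i≢0 , i≢L))
        where
        i≡position = sym (toℕ-position (<⇒≤ i<L))
        i≢0 = λ eq → <⇒≢ 0<i (sym (trans i≡position eq))
        i≢L = λ eq → <⇒≢ i<L (trans i≡position eq)

      interior-Paired : ∀ {i} → suc i < L → Paired (suc i) i ⊎ Paired (suc i) (suc (suc i))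
      interior-Paired {i} 1+i<L with partition (cube (suc i)) (cube-InRegion (suc i))
      ... | k , 1+i∈k , _
        with LiesAlong⇒neighbour-Paired (<⇒≤ 1+i<L) 1+i∈k (interior-LiesAlong (s≤s z≤n) 1+i<L 1+i∈k)
      ...   | j , inj₁ 1+j≡1+i , paired rewrite suc-injective 1+j≡1+i = inj₁ paired
      ...   | j , inj₂ refl    , paired = inj₂ paired

      every-index-Paired⇒tiled : (∀ {i} → i ≤ L → ∃ (Paired i)) → WireTiled D T e
      every-index-Paired⇒tiled paired p with paired (≤-pred (toℕ<n p))
      ... | j , i≤L , j≤L , i≢j , k , i∈k , j∈k =
        k , subst (λ x → InDomino x (lookup T k)) (cube-toℕ p) i∈k ,
        onWire (inj₁ refl) , onWire (inj₂ refl)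
        where
        onWire : ∀ {x} → InDomino x (lookup T k) → InWire e x
        onWire x∈k with InDomino-pair i∈k j∈k (cube≢ i≤L j≤L i≢j) x∈k
        ... | inj₁ x≡i = position (toℕ p) , sym x≡i
        ... | inj₂ x≡j = position j , sym x≡j

      endpoint-Paired : ∀ {v k} → Incident G v e → InDomino (f v) (lookup T k) →
        LiesAlong e (lookup T k) → Paired 0 1 ⊎ Σ ℕ λ j → suc j ≡ L × Paired L j
      endpoint-Paired (inj₁ refl) v∈k along
        with LiesAlong⇒neighbour-Paired z≤n (subst (λ x → InDomino x _) (sym cube-first) v∈k) along
      ... | _ , inj₁ () , _
      ... | _ , inj₂ refl , paired = inj₁ paired
      endpoint-Paired (inj₂ refl) v∈k along
        with LiesAlong⇒neighbour-Paired ≤-refl (subst (λ x → InDomino x _) (sym cube-last) v∈k) along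
      ... | j , inj₁ 1+j≡L , paired = inj₂ (j , 1+j≡L , paired)
      ... | _ , inj₂ refl , (_ , 1+L≤L , _) = contradiction 1+L≤L 1+n≰n

      tiled-from-endpoint : ∀ {v k} → parity (f (src e)) ≢ parity (f (tgt e)) → Incident G v e →
        InDomino (f v) (lookup T k) → LiesAlong e (lookup T k) → WireTiled D T e
      tiled-from-endpoint ends≢ inc v∈k along with odd-length ends≢
      ... | q , L≡1+2q = every-index-Paired⇒tiled λ i≤L →
        let h , h≤q , pair = end-pair in every-index-paired h≤q pair (subst (_ ≤_) L≡1+2q i≤L)
        where
        open PathPairing q Paired Paired-sym Paired-functional
          (λ 1+i<1+2q → interior-Paired (subst (_ <_) (sym L≡1+2q) 1+i<1+2q))
        end-pair : ∃ λ h → h ≤ q × EvenPair h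
        end-pair with endpoint-Paired inc v∈k along
        ... | inj₁ pair = 0 , z≤n , pair
        ... | inj₂ (j , 1+j≡L , pair) with suc-injective (trans 1+j≡L L≡1+2q)
        ...   | refl = q , ≤-refl , Paired-sym (subst (λ n → Paired n (q + q)) L≡1+2q pair)

    tiled-edge-exists : (∀ e → parity (f (src e)) ≢ parity (f (tgt e))) →
      ∀ {v e₀} → Incident G v e₀ → ∃ λ e → Incident G v e × WireTiled D T e
    tiled-edge-exists ends≢ {v} {e₀} inc₀ with partition (f v) (e₀ , endpoint-InWire inc₀)
    ... | k , v∈k , _ with domino-wire k
    ...   | e , along = e , inc , OnWire.tiled-from-endpoint e (ends≢ e) inc v∈k along
      where inc = InWire⇒Incident (LiesAlong⇒InWire along v∈k) inc₀

lemma3p2 : (G : Graph) → Connected G → Cubic G → Bipartite G →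
    (D : LatticeDrawing G) →
    (∀ e → parity (LatticeDrawing.f D (Graph.src G e))
             ≢ parity (LatticeDrawing.f D (Graph.tgt G e))) →
    (T : List Domino) → IsDominoTiling (LatticeDrawing.InRegion D) T →
    PerfectMatching G (WireTiled D T)
lemma3p2 G _ cubic _ D ends≢ T tiling v =
  let e , inc , tiled = tiled-edge-exists D tiling ends≢ (proj₂ (Cubic⇒incident {G} cubic v))
  in e , (inc , tiled) , λ e' (inc' , tiled') → tiled-edge-unique D tiling inc' tiled' inc tiled
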